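{- Let $\Gamma$ be an abelian group written additively and $(G,\varphi)$ a $\Gamma$-gain graph. Then $\mathcal L_\varphi$ is a linear class of bonds of $G$, i.e., $(G,\mathcal L_\varphi)$ is a cobiased graph.
   Context: Graphs are finite, loops and multiple edges allowed. A bond is a minimal nonempty edge cut; $\delta(X)$ is the set of links (non-loop edges) with exactly one endpoint in a vertex set $X$. A tribond corresponds to a partition $\{X_1,X_2,X_3\}$ of the vertex set of one connected component into nonempty sets with each $G[X_i]$ connected and an edge joining each pair; its bonds are $\delta(X_1),\delta(X_2),\delta(X_3)$. A linear class of bonds is a set $\mathcal L$ of bonds such that for each such tripartition the number of $i$ with $\delta(X_i)\in\mathcal L$ is never exactly two. Each edge has two orientations; $-e$ denotes the reverse of oriented edge $e$. A $\Gamma$-gain function is a map $\varphi$ from oriented edges to $\Gamma$ with $\varphi(-e)=-\varphi(e)$. An oriented bond $\vec B$ is a bond $B=\delta(X)$ with all edges oriented away from $X$ or all towards $X$; $\varphi(\vec B)=\sum_{e\in\vec B}\varphi(e)$. A bond $B$ is cobalanced if $\varphi(\vec B)=0$ (for either orientation), and $\mathcal L_\varphi$ is the set of cobalanced bonds. -}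

module Defs where

open import Level using (Level; _⊔_) renaming (suc to lsuc)
open import Data.Nat using (ℕ; zero; suc)
open import Data.Fin using (Fin; zero; suc)
open import Data.Bool using (Bool; true; false; not; _∧_; T; if_then_else_)
open import Data.Product using (Σ; ∃; _×_; _,_; proj₁; proj₂)
open import Relation.Nullary using (¬_)
open import Relation.Binary.PropositionalEquality using (_≡_)
open import Algebra.Bundles using (AbelianGroup)

record Graph : Set where
  field
    nV   : ℕ
    nE   : ℕ
    ends : Fin nE → Fin nV × Fin nV

open Graph public

module _ (G : Graph) where

  Vertex : Set
  Vertex = Fin (nV G)

  Edge : Set
  Edge = Fin (nE G)

  end₁ end₂ : Edge → Vertex
  end₁ e = proj₁ (ends G e)
  end₂ e = proj₂ (ends G e)

  VSet : Set
  VSet = Vertex → Bool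

  ESet : Set
  ESet = Edge → Bool

  _∈V_ : Vertex → VSet → Set
  v ∈V X = T (X v)

  _∈E_ : Edge → ESet → Set
  e ∈E B = T (B e)

  -- oriented edges: (e , true) runs from end₁ e to end₂ e,
  -- (e , false) is its reverse  -e
  OEdge : Set
  OEdge = Edge × Bool

  rev : OEdge → OEdge
  rev (e , b) = (e , not b)

  -- δ(X): links with exactly one endpoint in X  (loops never qualify)
  xor : Bool → Bool → Bool
  xor true  b = not b
  xor false b = b

  δ : VSet → ESet
  δ X e = xor (X (end₁ e)) (X (end₂ e))

  _≐_ : ESet → ESet → Set
  A ≐ B = ∀ e → A e ≡ B e

  _⊆E_ : ESet → ESet → Set
  A ⊆E B = ∀ e → e ∈E A → e ∈E B

  NonemptyE : ESet → Set
  NonemptyE B = ∃ λ e → e ∈E B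

  NonemptyV : VSet → Set
  NonemptyV X = ∃ λ v → v ∈V X

  IsCut : ESet → Set
  IsCut B = ∃ λ X → δ X ≐ B

  IsBond : ESet → Set
  IsBond B = IsCut B × NonemptyE B
           × (∀ B' → IsCut B' → NonemptyE B' → B' ⊆E B → B ⊆E B')

  data Reach (X : VSet) : Vertex → Vertex → Set where
    here : ∀ {u} → Reach X u u
    fwd  : ∀ {u} e → end₁ e ∈V X → end₂ e ∈V X →
           Reach X (end₂ e) u → Reach X (end₁ e) u
    bwd  : ∀ {u} e → end₁ e ∈V X → end₂ e ∈V X →
           Reach X (end₁ e) u → Reach X (end₂ e) u

  InducedConnected : VSet → Set
  InducedConnected X =
    NonemptyV X × (∀ u v → u ∈V X → v ∈V X → Reach X u v)

  IsComponent : VSet → Set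
  IsComponent C =
    InducedConnected C
    × (∀ e → (end₁ e ∈V C → end₂ e ∈V C) × (end₂ e ∈V C → end₁ e ∈V C))

  Joined : VSet → VSet → Set
  Joined X Y = ∃ λ e → (end₁ e ∈V X × end₂ e ∈V Y)
                     Data.Sum.⊎ (end₁ e ∈V Y × end₂ e ∈V X)
    where import Data.Sum

  IsTribondPartition : VSet → (Fin 3 → VSet) → Set
  IsTribondPartition C X =
    IsComponent C
    × (∀ v → v ∈V C → ∃ λ i → v ∈V X i)
    × (∀ i v → v ∈V X i → v ∈V C)
    × (∀ i j v → v ∈V X i → v ∈V X j → i ≡ j)
    × (∀ i → InducedConnected (X i))
    × (∀ i j → ¬ i ≡ j → Joined (X i) (X j))

  -- linear class of bonds: a set 𝓛 of bonds such that no tribond has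
  -- exactly two of its bonds in 𝓛 (stated as: two in 𝓛 ⇒ the third in 𝓛)
  IsLinearClass : ∀ {ℓ} → (ESet → Set ℓ) → Set ℓ
  IsLinearClass 𝓛 =
    (∀ B → 𝓛 B → IsBond B)
    × (∀ C X → IsTribondPartition C X →
         ∀ i j k → ¬ i ≡ j → ¬ j ≡ k → ¬ i ≡ k →
         𝓛 (δ (X j)) → 𝓛 (δ (X k)) → 𝓛 (δ (X i)))

module _ {c ℓ : Level} (Γ : AbelianGroup c ℓ) (G : Graph) where
  open AbelianGroup Γ renaming (Carrier to A)

  record GainFunction : Set (c ⊔ ℓ) where
    field
      φ       : OEdge G → A
      φ-rev   : ∀ e → φ (rev G e) ≈ (φ e) ⁻¹

  sumFin : ∀ {k} → (Fin k → A) → A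
  sumFin {zero}  f = ε
  sumFin {suc k} f = f zero ∙ sumFin (λ i → f (suc i))

  module _ (g : GainFunction) where
    open GainFunction g

    -- orientation of edge e away from X (meaningful when e ∈ δ(X))
    awayFrom : VSet G → Edge G → OEdge G
    awayFrom X e = (e , X (end₁ G e))

    gainOut : VSet G → A
    gainOut X = sumFin (λ e → if δ G X e then φ (awayFrom X e) else ε)

    Cobalanced : ESet G → Set ℓ
    Cobalanced B = IsBond G B × ∃ λ X → (_≐_ G (δ G X) B) × (gainOut X ≈ ε)

-- For a part X a of a tribond, a nonempty cut δ Z ⊆ δ (X a) is, on the component, the cut of X a or of
-- its complement: Z △ X a is constant on each part (these are connected and no edge inside a part lies in
-- δ (X a)), across the edge of δ Z leaving X a, and across the edges joining the two other parts. Hence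
-- every δ (X a) is a bond, and it is cobalanced exactly when the gain of X a itself vanishes. The outward
-- gain is additive over disjoint vertex sets, because an edge between them contributes φ(e) + φ(−e) = 0,
-- and vanishes on the component, so the gains of the three parts sum to 0.
module Submission where

open import Level using (Level)
open import Algebra.Bundles using (AbelianGroup; CommutativeRing)
open import Defs
open import Data.Bool using (Bool; true; false; T; _∨_; if_then_else_) renaming (_xor_ to _⊻_)
open import Data.Bool.Properties using (T-∨; xor-∧-commutativeRing)
open import Data.Empty using (⊥; ⊥-elim)
open import Data.Fin using (Fin; zero; suc; _≟_)
open import Data.Fin.Properties using (all?)
import Data.Nat as ℕ
open import Data.Product using (∃; _×_; _,_; proj₁; proj₂)
open import Data.Sum using (_⊎_; inj₁; inj₂; [_,_])
open import Data.Unit using (tt)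
open import Function using (_∘_; Equivalence)
open import Relation.Nullary using (¬_; yes; no)
open import Relation.Nullary.Decidable using (toWitness; _→-dec_; _⊎-dec_; ¬?)
open import Relation.Binary.PropositionalEquality
  using (_≡_; _≢_; refl; sym; trans; cong; cong₂; subst; module ≡-Reasoning)
open import Algebra.Properties.CommutativeSemigroup
  (CommutativeRing.+-commutativeSemigroup xor-∧-commutativeRing) using (interchange)

fin3-cover : ∀ (i j k m : Fin 3) → i ≢ j → j ≢ k → i ≢ k → m ≡ i ⊎ m ≡ j ⊎ m ≡ k
fin3-cover = toWitness {a? = all? λ i → all? λ j → all? λ k → all? λ m →
  ¬? (i ≟ j) →-dec ¬? (j ≟ k) →-dec ¬? (i ≟ k) →-dec (m ≟ i ⊎-dec m ≟ j ⊎-dec m ≟ k)} _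

another : (a : Fin 3) → ∃ λ b → a ≢ b
another zero    = suc zero , λ ()
another (suc _) = zero , λ ()

T-⇔→≡ : ∀ {a b} → (T a → T b) → (T b → T a) → a ≡ b
T-⇔→≡ {false} {false} _ _ = refl
T-⇔→≡ {false} {true}  _ g = ⊥-elim (g tt)
T-⇔→≡ {true}  {false} f _ = ⊥-elim (f tt)
T-⇔→≡ {true}  {true}  _ _ = refl

¬T-both⇒≡ : ∀ {a b} → ¬ T a → ¬ T b → a ≡ b
¬T-both⇒≡ ¬a ¬b = T-⇔→≡ (⊥-elim ∘ ¬a) (⊥-elim ∘ ¬b)

module Cuts (G : Graph) where

  xor≡⊻ : ∀ a b → xor G a b ≡ a ⊻ b
  xor≡⊻ false _ = refl
  xor≡⊻ true  _ = refl

  xor-interchange : ∀ a b c d → xor G (xor G a b) (xor G c d) ≡ xor G (xor G a c) (xor G b d)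
  xor-interchange a b c d = begin
    xor G (xor G a b) (xor G c d) ≡⟨ xor₂≡⊻₂ a b c d ⟩
    (a ⊻ b) ⊻ (c ⊻ d)             ≡⟨ interchange a b c d ⟩
    (a ⊻ c) ⊻ (b ⊻ d)             ≡⟨ xor₂≡⊻₂ a c b d ⟨
    xor G (xor G a c) (xor G b d) ∎
    where
    open ≡-Reasoning
    xor₂≡⊻₂ : ∀ a b c d → xor G (xor G a b) (xor G c d) ≡ (a ⊻ b) ⊻ (c ⊻ d)
    xor₂≡⊻₂ a b c d = trans (cong₂ (xor G) (xor≡⊻ a b) (xor≡⊻ c d)) (xor≡⊻ (a ⊻ b) (c ⊻ d))

  xor-self : ∀ a → xor G a a ≡ false
  xor-self false = refl
  xor-self true  = refl

  xor-cancelʳ : ∀ a b → xor G (xor G a b) b ≡ a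
  xor-cancelʳ false false = refl
  xor-cancelʳ false true  = refl
  xor-cancelʳ true  false = refl
  xor-cancelʳ true  true  = refl

  ¬T-xor⇒≡ : ∀ {a b} → ¬ T (xor G a b) → a ≡ b
  ¬T-xor⇒≡ {false} {false} _ = refl
  ¬T-xor⇒≡ {false} {true}  n = ⊥-elim (n tt)
  ¬T-xor⇒≡ {true}  {false} n = ⊥-elim (n tt)
  ¬T-xor⇒≡ {true}  {true}  _ = refl

  T-xor⇒exactly-one : ∀ {a b} → T (xor G a b) → (T a × ¬ T b) ⊎ (¬ T a × T b)
  T-xor⇒exactly-one {false} {true}  _ = inj₂ ((λ ()) , tt)
  T-xor⇒exactly-one {true}  {false} _ = inj₁ (tt , λ ())
  T-xor⇒exactly-one {false} {false} ()
  T-xor⇒exactly-one {true}  {true}  ()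

  exactly-one⇒T-xor : ∀ {a b} → (T a × ¬ T b) ⊎ (¬ T a × T b) → T (xor G a b)
  exactly-one⇒T-xor {false} {false} = [ proj₁ , proj₂ ]
  exactly-one⇒T-xor {false} {true}  _ = tt
  exactly-one⇒T-xor {true}  {false} _ = tt
  exactly-one⇒T-xor {true}  {true}  = [ (λ p → proj₂ p tt) , (λ p → proj₁ p tt) ]

  _∈_ : Vertex G → VSet G → Set
  v ∈ X = _∈V_ G v X

  _△_ : VSet G → VSet G → VSet G
  (Z △ W) v = xor G (Z v) (W v)

  _∪_ : VSet G → VSet G → VSet G
  (X ∪ Y) v = X v ∨ Y v

  Disjoint : VSet G → VSet G → Set
  Disjoint X Y = ∀ v → v ∈ X → v ∈ Y → ⊥

  Links : Edge G → VSet G → VSet G → Set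
  Links e X Y = (end₁ G e ∈ X × end₂ G e ∈ Y) ⊎ (end₁ G e ∈ Y × end₂ G e ∈ X)

  ConstantOn : VSet G → VSet G → Set
  ConstantOn D X = ∀ u v → u ∈ X → v ∈ X → D u ≡ D v

  ∈-∪⁺ˡ : ∀ X Y v → v ∈ X → v ∈ (X ∪ Y)
  ∈-∪⁺ˡ X Y v = Equivalence.from (T-∨ {X v} {Y v}) ∘ inj₁

  ∈-∪⁺ʳ : ∀ X Y v → v ∈ Y → v ∈ (X ∪ Y)
  ∈-∪⁺ʳ X Y v = Equivalence.from (T-∨ {X v} {Y v}) ∘ inj₂

  ∈-∪⁻ : ∀ X Y v → v ∈ (X ∪ Y) → v ∈ X ⊎ v ∈ Y
  ∈-∪⁻ X Y v = Equivalence.to (T-∨ {X v} {Y v})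

  Disjoint-∪ : ∀ X Y Z → Disjoint X Y → Disjoint X Z → Disjoint X (Y ∪ Z)
  Disjoint-∪ X Y Z X∩Y X∩Z v v∈X v∈Y∪Z = [ X∩Y v v∈X , X∩Z v v∈X ] (∈-∪⁻ Y Z v v∈Y∪Z)

  ≐⇒⊆ : ∀ {A B} → _≐_ G A B → _⊆E_ G A B
  ≐⇒⊆ A≐B e = subst T (A≐B e)

  δ-steady : ∀ W e → W (end₁ G e) ≡ W (end₂ G e) → ¬ T (δ G W e)
  δ-steady W e same = subst T (trans (cong (xor G (W (end₁ G e))) (sym same)) (xor-self (W (end₁ G e))))

  δ-link : ∀ W Y e → Disjoint W Y → Links e W Y → T (δ G W e)
  δ-link W Y e W∩Y (inj₁ (x₁ , y₂)) = exactly-one⇒T-xor (inj₁ (x₁ , λ x₂ → W∩Y _ x₂ y₂))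
  δ-link W Y e W∩Y (inj₂ (y₁ , x₂)) = exactly-one⇒T-xor (inj₂ ((λ x₁ → W∩Y _ x₁ y₁) , x₂))

  δ-△ : ∀ Z W e → δ G (Z △ W) e ≡ xor G (δ G Z e) (δ G W e)
  δ-△ Z W e = xor-interchange (Z (end₁ G e)) (W (end₁ G e)) (Z (end₂ G e)) (W (end₂ G e))

  δ-△-⊆ : ∀ Z W → _⊆E_ G (δ G Z) (δ G W) → ∀ e → T (δ G (Z △ W) e) → T (δ G W e) × ¬ T (δ G Z e)
  δ-△-⊆ Z W δZ⊆δW e e∈δ△ = separate (δZ⊆δW e) (subst T (δ-△ Z W e) e∈δ△)
    where
    separate : ∀ {z w} → (T z → T w) → T (xor G z w) → T w × ¬ T z
    separate {false} {true}  _   _  = tt , λ ()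
    separate {true}  {true}  _   ()
    separate {false} {false} _   ()
    separate {true}  {false} z→w _  = ⊥-elim (z→w tt)

  δ-flip : ∀ Z W e s → Z (end₁ G e) ≡ xor G s (W (end₁ G e)) → Z (end₂ G e) ≡ xor G s (W (end₂ G e)) →
           δ G Z e ≡ δ G W e
  δ-flip Z W e s side₁ side₂ = begin
    xor G (Z (end₁ G e)) (Z (end₂ G e))                     ≡⟨ cong₂ (xor G) side₁ side₂ ⟩
    xor G (xor G s (W (end₁ G e))) (xor G s (W (end₂ G e))) ≡⟨ xor-interchange s _ s _ ⟩
    xor G (xor G s s) (δ G W e)                             ≡⟨ cong (λ b → xor G b (δ G W e)) (xor-self s) ⟩
    δ G W e                                                 ∎
    where open ≡-Reasoning

  reach-constant : ∀ D {X} → (∀ e → end₁ G e ∈ X → end₂ G e ∈ X → ¬ T (δ G D e)) →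
                   ∀ {u v} → Reach G X u v → D u ≡ D v
  reach-constant D steady here               = refl
  reach-constant D steady (fwd e x₁ x₂ walk) =
    trans (¬T-xor⇒≡ (steady e x₁ x₂)) (reach-constant D steady walk)
  reach-constant D steady (bwd e x₁ x₂ walk) =
    trans (sym (¬T-xor⇒≡ (steady e x₁ x₂))) (reach-constant D steady walk)

  connected-constant : ∀ D X → InducedConnected G X →
                       (∀ e → end₁ G e ∈ X → end₂ G e ∈ X → ¬ T (δ G D e)) → ConstantOn D X
  connected-constant D X (_ , reach) steady u v u∈X v∈X = reach-constant D steady (reach u v u∈X v∈X)

  link-constant : ∀ D {X Y} e → ConstantOn D X → ConstantOn D Y → Links e X Y → ¬ T (δ G D e) →
                  ∀ u v → u ∈ X → v ∈ Y → D u ≡ D v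
  link-constant D e onX onY (inj₁ (x₁ , y₂)) e∉δD u v u∈X v∈Y =
    trans (onX u _ u∈X x₁) (trans (¬T-xor⇒≡ e∉δD) (onY _ v y₂ v∈Y))
  link-constant D e onX onY (inj₂ (y₁ , x₂)) e∉δD u v u∈X v∈Y =
    trans (onX u _ u∈X x₂) (trans (sym (¬T-xor⇒≡ e∉δD)) (onY _ v y₁ v∈Y))

  module Tribond {C : VSet G} {X : Fin 3 → VSet G} (P : IsTribondPartition G C X) where

    private
      closed : ∀ e → (end₁ G e ∈ C → end₂ G e ∈ C) × (end₂ G e ∈ C → end₁ G e ∈ C)
      closed = proj₂ (proj₁ P)
      covers : ∀ v → v ∈ C → ∃ λ m → v ∈ X m
      covers = proj₁ (proj₂ P)
      inside : ∀ m v → v ∈ X m → v ∈ C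
      inside = proj₁ (proj₂ (proj₂ P))
      disjoint : ∀ m n v → v ∈ X m → v ∈ X n → m ≡ n
      disjoint = proj₁ (proj₂ (proj₂ (proj₂ P)))
      connected : ∀ m → InducedConnected G (X m)
      connected = proj₁ (proj₂ (proj₂ (proj₂ (proj₂ P))))
      joined : ∀ m n → m ≢ n → Joined G (X m) (X n)
      joined = proj₂ (proj₂ (proj₂ (proj₂ (proj₂ P))))

    C-closed : ∀ e → C (end₁ G e) ≡ C (end₂ G e)
    C-closed e = T-⇔→≡ (proj₁ (closed e)) (proj₂ (closed e))

    parts-disjoint : ∀ {m n} → m ≢ n → Disjoint (X m) (X n)
    parts-disjoint m≢n v v∈m v∈n = m≢n (disjoint _ _ v v∈m v∈n)

    part-constant : ∀ a m → ConstantOn (X a) (X m)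
    part-constant a m u v u∈m v∈m = T-⇔→≡ (move u v u∈m v∈m) (move v u v∈m u∈m)
      where
      move : ∀ u v → u ∈ X m → v ∈ X m → u ∈ X a → v ∈ X a
      move u v u∈m v∈m u∈a = subst (λ n → v ∈ X n) (disjoint m a u u∈m u∈a) v∈m

    outside : ∀ {a m} v → a ≢ m → v ∈ X m → ¬ v ∈ X a
    outside v a≢m v∈m v∈a = parts-disjoint a≢m v v∈a v∈m

    link-avoids : ∀ {a m n} e → a ≢ m → a ≢ n → Links e (X m) (X n) → X a (end₁ G e) ≡ X a (end₂ G e)
    link-avoids e a≢m a≢n (inj₁ (x₁ , x₂)) = ¬T-both⇒≡ (outside _ a≢m x₁) (outside _ a≢n x₂)
    link-avoids e a≢m a≢n (inj₂ (x₁ , x₂)) = ¬T-both⇒≡ (outside _ a≢n x₁) (outside _ a≢m x₂)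

    other-part : ∀ {a v} → v ∈ C → ¬ v ∈ X a → ∃ λ b → a ≢ b × v ∈ X b
    other-part v∈C v∉a with covers _ v∈C
    ... | b , v∈b = b , (λ { refl → v∉a v∈b }) , v∈b

    δ-part-tail : ∀ {a e} → T (δ G (X a) e) → end₁ G e ∈ C
    δ-part-tail {a} e∈δ with T-xor⇒exactly-one e∈δ
    ... | inj₁ (x₁ , _) = inside a _ x₁
    ... | inj₂ (_ , x₂) = proj₂ (closed _) (inside a _ x₂)

    δ-part-link : ∀ {a e} → T (δ G (X a) e) → ∃ λ b → a ≢ b × Links e (X a) (X b)
    δ-part-link {a} {e} e∈δ with T-xor⇒exactly-one e∈δ
    ... | inj₁ (x₁ , x₂∉a) with other-part (proj₁ (closed e) (inside a _ x₁)) x₂∉a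
    ...   | b , a≢b , x₂ = b , a≢b , inj₁ (x₁ , x₂)
    δ-part-link {a} {e} e∈δ | inj₂ (x₁∉a , x₂) with other-part (proj₂ (closed e) (inside a _ x₂)) x₁∉a
    ...   | b , a≢b , x₁ = b , a≢b , inj₂ (x₁ , x₂)

    subcut-side : ∀ Z a → NonemptyE G (δ G Z) → _⊆E_ G (δ G Z) (δ G (X a)) →
                  ∃ λ s → ∀ v → v ∈ C → Z v ≡ xor G s (X a v)
    subcut-side Z a (e₀ , e₀∈δZ) δZ⊆δXa with δ-part-link (δZ⊆δXa e₀ e₀∈δZ)
    ... | b , a≢b , link₀ = D p , λ v v∈C →
            trans (sym (xor-cancelʳ (Z v) (X a v))) (cong (λ d → xor G d (X a v)) (D-on-C v v∈C))
      where
      D : VSet G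
      D = Z △ X a
      p r : Vertex G
      p = proj₁ (proj₁ (connected a))
      r = proj₁ (proj₁ (connected b))
      p∈a : p ∈ X a
      p∈a = proj₂ (proj₁ (connected a))
      r∈b : r ∈ X b
      r∈b = proj₂ (proj₁ (connected b))

      D-steady : ∀ e → X a (end₁ G e) ≡ X a (end₂ G e) → ¬ T (δ G D e)
      D-steady e same e∈δD = δ-steady (X a) e same (proj₁ (δ-△-⊆ Z (X a) δZ⊆δXa e e∈δD))

      D-part : ∀ m → ConstantOn D (X m)
      D-part m = connected-constant D (X m) (connected m)
                   (λ e x₁ x₂ → D-steady e (part-constant a m _ _ x₁ x₂))

      a~b : ∀ u v → u ∈ X a → v ∈ X b → D u ≡ D v
      a~b = link-constant D e₀ (D-part a) (D-part b) link₀
              (λ e₀∈δD → proj₂ (δ-△-⊆ Z (X a) δZ⊆δXa e₀ e₀∈δD) e₀∈δZ)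

      D-on-C : ∀ v → v ∈ C → D v ≡ D p
      D-on-C v v∈C with covers v v∈C
      ... | m , v∈m with a ≟ m | b ≟ m
      ...   | yes refl | _        = D-part a v p v∈m p∈a
      ...   | no _     | yes refl = sym (a~b p v p∈a v∈m)
      ...   | no a≢m   | no b≢m   with joined b m b≢m
      ...     | e , link = sym (trans (a~b p r p∈a r∈b) b~m)
        where
        b~m : D r ≡ D v
        b~m = link-constant D e (D-part b) (D-part m) link
                (D-steady e (link-avoids e a≢b a≢m link)) r v r∈b v∈m

    δ-part-minimal : ∀ Z a → NonemptyE G (δ G Z) → _⊆E_ G (δ G Z) (δ G (X a)) →
                     _⊆E_ G (δ G (X a)) (δ G Z)
    δ-part-minimal Z a nonempty δZ⊆δXa e e∈δXa with subcut-side Z a nonempty δZ⊆δXa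
    ... | s , side = subst T (sym (δ-flip Z (X a) e s (side _ tail) (side _ head))) e∈δXa
      where
      tail : end₁ G e ∈ C
      tail = δ-part-tail e∈δXa
      head : end₂ G e ∈ C
      head = proj₁ (closed e) tail

    part-bond : ∀ a → IsBond G (δ G (X a))
    part-bond a = (X a , λ _ → refl) , nonempty , minimal
      where
      nonempty : NonemptyE G (δ G (X a))
      nonempty with another a
      ... | b , a≢b with joined a b a≢b
      ...   | e , link = e , δ-link (X a) (X b) e (parts-disjoint a≢b) link
      minimal : ∀ B → IsCut G B → NonemptyE G B → _⊆E_ G B (δ G (X a)) → _⊆E_ G (δ G (X a)) B
      minimal B (Z , δZ≐B) (e₀ , e₀∈B) B⊆δXa e =
        ≐⇒⊆ δZ≐B e ∘ δ-part-minimal Z a (e₀ , ≐⇒⊆ (sym ∘ δZ≐B) e₀ e₀∈B) δZ⊆δXa e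
        where
        δZ⊆δXa : _⊆E_ G (δ G Z) (δ G (X a))
        δZ⊆δXa e = B⊆δXa e ∘ ≐⇒⊆ δZ≐B e

    parts-closed : ∀ {i j k} → i ≢ j → j ≢ k → i ≢ k →
                   ∀ e → (X i ∪ (X j ∪ X k)) (end₁ G e) ≡ (X i ∪ (X j ∪ X k)) (end₂ G e)
    parts-closed {i} {j} {k} i≢j j≢k i≢k e =
      trans (parts-cover _) (trans (C-closed e) (sym (parts-cover _)))
      where
      parts-cover : ∀ v → (X i ∪ (X j ∪ X k)) v ≡ C v
      parts-cover v = T-⇔→≡ to from
        where
        to : v ∈ (X i ∪ (X j ∪ X k)) → v ∈ C
        to v∈U = [ inside i v , [ inside j v , inside k v ] ∘ ∈-∪⁻ (X j) (X k) v ]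
                   (∈-∪⁻ (X i) (X j ∪ X k) v v∈U)
        from : v ∈ C → v ∈ (X i ∪ (X j ∪ X k))
        from v∈C with covers v v∈C
        ... | m , v∈m with fin3-cover i j k m i≢j j≢k i≢k
        ...   | inj₁ refl        = ∈-∪⁺ˡ (X i) (X j ∪ X k) v v∈m
        ...   | inj₂ (inj₁ refl) = ∈-∪⁺ʳ (X i) (X j ∪ X k) v (∈-∪⁺ˡ (X j) (X k) v v∈m)
        ...   | inj₂ (inj₂ refl) = ∈-∪⁺ʳ (X i) (X j ∪ X k) v (∈-∪⁺ʳ (X j) (X k) v v∈m)

module _ {c ℓ : Level} (Γ : AbelianGroup c ℓ) where

  open AbelianGroup Γ renaming (Carrier to A; refl to ≈-refl; sym to ≈-sym; trans to ≈-trans)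
  open import Algebra.Properties.Group group using (ε⁻¹≈ε; ⁻¹-injective)
  open import Algebra.Properties.AbelianGroup Γ using (⁻¹-∙-comm)
  open import Algebra.Properties.CommutativeMonoid.Sum commutativeMonoid
    using (sum; sum-cong-≋; sum-replicate-zero; ∑-distrib-+)
  open import Relation.Binary.Reasoning.Setoid setoid

  invertIf : Bool → A → A
  invertIf false x = x
  invertIf true  x = x ⁻¹

  invertIf-ε : ∀ s → invertIf s ε ≈ ε
  invertIf-ε false = ≈-refl
  invertIf-ε true  = ε⁻¹≈ε

  invertIf-≈ε : ∀ s {x} → invertIf s x ≈ ε → x ≈ ε
  invertIf-≈ε false x≈ε  = x≈ε
  invertIf-≈ε true  x⁻¹≈ε = ⁻¹-injective (≈-trans x⁻¹≈ε (≈-sym ε⁻¹≈ε))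

  x∙[y∙z]≈ε⇒x≈ε : ∀ {x y z} → x ∙ (y ∙ z) ≈ ε → y ≈ ε → z ≈ ε → x ≈ ε
  x∙[y∙z]≈ε⇒x≈ε {x} {y} {z} x∙[y∙z]≈ε y≈ε z≈ε = begin
    x           ≈⟨ identityʳ x ⟨
    x ∙ ε       ≈⟨ ∙-congˡ (≈-trans (∙-cong y≈ε z≈ε) (identityˡ ε)) ⟨
    x ∙ (y ∙ z) ≈⟨ x∙[y∙z]≈ε ⟩
    ε           ∎

  ∑-⁻¹ : ∀ {n} (f : Fin n → A) → sum (λ i → f i ⁻¹) ≈ sum f ⁻¹
  ∑-⁻¹ {ℕ.zero}  f = ≈-sym ε⁻¹≈ε
  ∑-⁻¹ {ℕ.suc n} f = ≈-trans (∙-congˡ (∑-⁻¹ (f ∘ suc))) (⁻¹-∙-comm (f zero) (sum (f ∘ suc)))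

  ∑-invertIf : ∀ s {n} (f : Fin n → A) → sum (invertIf s ∘ f) ≈ invertIf s (sum f)
  ∑-invertIf false f = ≈-refl
  ∑-invertIf true  f = ∑-⁻¹ f

  ∑-≈ε : ∀ {n} (f : Fin n → A) → (∀ i → f i ≈ ε) → sum f ≈ ε
  ∑-≈ε {n} f f≈ε = ≈-trans (sum-cong-≋ f≈ε) (sum-replicate-zero n)

  module _ {G : Graph} (g : GainFunction Γ G) where

    open GainFunction g
    open Cuts G

    sumFin≡sum : ∀ {n} (f : Fin n → A) → sumFin Γ G f ≡ sum f
    sumFin≡sum {ℕ.zero}  f = refl
    sumFin≡sum {ℕ.suc n} f = cong (f zero ∙_) (sumFin≡sum (f ∘ suc))

    edgeGain : Edge G → Bool → Bool → A
    edgeGain e x₁ x₂ = if xor G x₁ x₂ then φ (e , x₁) else ε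

    edgeGains : VSet G → Edge G → A
    edgeGains X e = edgeGain e (X (end₁ G e)) (X (end₂ G e))

    gainOut≡∑ : ∀ X → gainOut Γ G g X ≡ sum (edgeGains X)
    gainOut≡∑ X = sumFin≡sum (edgeGains X)

    edgeGain-steady : ∀ e {x₁ x₂} → x₁ ≡ x₂ → edgeGain e x₁ x₂ ≈ ε
    edgeGain-steady e {false} refl = ≈-refl
    edgeGain-steady e {true}  refl = ≈-refl

    φ-cancel : ∀ e → φ (e , true) ∙ φ (e , false) ≈ ε
    φ-cancel e = ≈-trans (∙-congˡ (φ-rev (e , true))) (inverseʳ _)

    φ-cancel′ : ∀ e → φ (e , false) ∙ φ (e , true) ≈ ε
    φ-cancel′ e = ≈-trans (∙-congʳ (φ-rev (e , true))) (inverseˡ _)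

    edgeGain-∨ : ∀ e x₁ y₁ x₂ y₂ → ¬ (T x₁ × T y₁) → ¬ (T x₂ × T y₂) →
                 edgeGain e (x₁ ∨ y₁) (x₂ ∨ y₂) ≈ edgeGain e x₁ x₂ ∙ edgeGain e y₁ y₂
    edgeGain-∨ e true  true  _     _     d₁ _  = ⊥-elim (d₁ (tt , tt))
    edgeGain-∨ e _     _     true  true  _  d₂ = ⊥-elim (d₂ (tt , tt))
    edgeGain-∨ e false false false false _  _  = ≈-sym (identityˡ ε)
    edgeGain-∨ e false false false true  _  _  = ≈-sym (identityˡ _)
    edgeGain-∨ e false false true  false _  _  = ≈-sym (identityʳ _)
    edgeGain-∨ e false true  false false _  _  = ≈-sym (identityˡ _)
    edgeGain-∨ e false true  false true  _  _  = ≈-sym (identityˡ ε)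
    edgeGain-∨ e false true  true  false _  _  = ≈-sym (φ-cancel′ e)
    edgeGain-∨ e true  false false false _  _  = ≈-sym (identityʳ _)
    edgeGain-∨ e true  false false true  _  _  = ≈-sym (φ-cancel e)
    edgeGain-∨ e true  false true  false _  _  = ≈-sym (identityˡ ε)

    φ-xor : ∀ e s b → φ (e , xor G s b) ≈ invertIf s (φ (e , b))
    φ-xor e false b = ≈-refl
    φ-xor e true  b = φ-rev (e , b)

    edgeGain-flip : ∀ e s {y₁ y₂ w₁ w₂} → xor G y₁ y₂ ≡ xor G w₁ w₂ →
                    (T (xor G w₁ w₂) → y₁ ≡ xor G s w₁) →
                    edgeGain e y₁ y₂ ≈ invertIf s (edgeGain e w₁ w₂)
    edgeGain-flip e s {y₁} {y₂} {w₁} {w₂} same tail with xor G w₁ w₂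
    ... | false rewrite same = ≈-sym (invertIf-ε s)
    ... | true  rewrite same | tail tt = φ-xor e s w₁

    gainOut-∪ : ∀ X Y → Disjoint X Y → gainOut Γ G g (X ∪ Y) ≈ gainOut Γ G g X ∙ gainOut Γ G g Y
    gainOut-∪ X Y X∩Y = begin
      gainOut Γ G g (X ∪ Y)                       ≡⟨ gainOut≡∑ (X ∪ Y) ⟩
      sum (edgeGains (X ∪ Y))                     ≈⟨ sum-cong-≋ edgeGains-∪ ⟩
      sum (λ e → edgeGains X e ∙ edgeGains Y e)   ≈⟨ ∑-distrib-+ (edgeGains X) (edgeGains Y) ⟩
      sum (edgeGains X) ∙ sum (edgeGains Y)       ≡⟨ cong₂ _∙_ (gainOut≡∑ X) (gainOut≡∑ Y) ⟨
      gainOut Γ G g X ∙ gainOut Γ G g Y           ∎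
      where
      apart : ∀ v → ¬ (v ∈ X × v ∈ Y)
      apart v (v∈X , v∈Y) = X∩Y v v∈X v∈Y
      edgeGains-∪ : ∀ e → edgeGains (X ∪ Y) e ≈ edgeGains X e ∙ edgeGains Y e
      edgeGains-∪ e = edgeGain-∨ e (X (end₁ G e)) (Y (end₁ G e)) (X (end₂ G e)) (Y (end₂ G e))
                        (apart (end₁ G e)) (apart (end₂ G e))

    gainOut-closed : ∀ U → (∀ e → U (end₁ G e) ≡ U (end₂ G e)) → gainOut Γ G g U ≈ ε
    gainOut-closed U closed =
      ≈-trans (reflexive (gainOut≡∑ U)) (∑-≈ε (edgeGains U) (λ e → edgeGain-steady e (closed e)))

    gainOut-flip : ∀ Y W s → _≐_ G (δ G Y) (δ G W) →
                   (∀ e → T (δ G W e) → Y (end₁ G e) ≡ xor G s (W (end₁ G e))) →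
                   gainOut Γ G g Y ≈ invertIf s (gainOut Γ G g W)
    gainOut-flip Y W s δY≐δW tail = begin
      gainOut Γ G g Y                      ≡⟨ gainOut≡∑ Y ⟩
      sum (edgeGains Y)                    ≈⟨ sum-cong-≋ (λ e → edgeGain-flip e s (δY≐δW e) (tail e)) ⟩
      sum (invertIf s ∘ edgeGains W)       ≈⟨ ∑-invertIf s (edgeGains W) ⟩
      invertIf s (sum (edgeGains W))       ≡⟨ cong (invertIf s) (gainOut≡∑ W) ⟨
      invertIf s (gainOut Γ G g W)         ∎

    module _ {C : VSet G} {X : Fin 3 → VSet G} (P : IsTribondPartition G C X) where

      open Tribond P

      cobalanced-part-gain : ∀ a → Cobalanced Γ G g (δ G (X a)) → gainOut Γ G g (X a) ≈ ε
      cobalanced-part-gain a ((_ , (e₀ , e₀∈δXa) , _) , Y , δY≐δXa , gainY≈ε)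
        with subcut-side Y a (e₀ , ≐⇒⊆ (sym ∘ δY≐δXa) e₀ e₀∈δXa) (≐⇒⊆ δY≐δXa)
      ... | s , side = invertIf-≈ε s (≈-trans (≈-sym (gainOut-flip Y (X a) s δY≐δXa tail)) gainY≈ε)
        where
        tail : ∀ e → T (δ G (X a) e) → Y (end₁ G e) ≡ xor G s (X a (end₁ G e))
        tail e e∈δXa = side (end₁ G e) (δ-part-tail e∈δXa)

      parts-gain : ∀ {i j k} → i ≢ j → j ≢ k → i ≢ k →
                   gainOut Γ G g (X i) ∙ (gainOut Γ G g (X j) ∙ gainOut Γ G g (X k)) ≈ ε
      parts-gain {i} {j} {k} i≢j j≢k i≢k = begin
        gainOut Γ G g (X i) ∙ (gainOut Γ G g (X j) ∙ gainOut Γ G g (X k))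
          ≈⟨ ∙-congˡ (gainOut-∪ (X j) (X k) (parts-disjoint j≢k)) ⟨
        gainOut Γ G g (X i) ∙ gainOut Γ G g (X j ∪ X k)
          ≈⟨ gainOut-∪ (X i) (X j ∪ X k)
               (Disjoint-∪ (X i) (X j) (X k) (parts-disjoint i≢j) (parts-disjoint i≢k)) ⟨
        gainOut Γ G g (X i ∪ (X j ∪ X k))
          ≈⟨ gainOut-closed (X i ∪ (X j ∪ X k)) (parts-closed i≢j j≢k i≢k) ⟩
        ε ∎

proposition4p1 : ∀ {c ℓ : Level} (Γ : AbelianGroup c ℓ) (G : Graph)
    (φ : GainFunction Γ G) → IsLinearClass G (Cobalanced Γ G φ)
proposition4p1 Γ G g = (λ _ → proj₁) , third-cobalanced
  where
  open Cuts G using (module Tribond)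
  third-cobalanced : ∀ C X → IsTribondPartition G C X → ∀ i j k → i ≢ j → j ≢ k → i ≢ k →
                     Cobalanced Γ G g (δ G (X j)) → Cobalanced Γ G g (δ G (X k)) →
                     Cobalanced Γ G g (δ G (X i))
  third-cobalanced C X P i j k i≢j j≢k i≢k cob-j cob-k =
    Tribond.part-bond P i , X i , (λ _ → refl) ,
    x∙[y∙z]≈ε⇒x≈ε Γ (parts-gain Γ g P i≢j j≢k i≢k)
                    (cobalanced-part-gain Γ g P j cob-j) (cobalanced-part-gain Γ g P k cob-k)
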